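{- Consider the random-fixed-price policy: initially draw a random price $P$ equal to $r^{(j)}$ with probability $q^{(j)}/q$ for each $j\in\{1,\ldots,m\}$, and offer price $P$ to every customer as long as inventory remains. This policy is $c^*(\mathcal{P})$-competitive: for every $T\ge1$ and every sequence $V_1,\ldots,V_T\in\{r^{(0)},\ldots,r^{(m)}\}$, $\mathbb{E}[\mathsf{ALG}(V_1,\ldots,V_T)]\ge c^*(\mathcal{P})\,\mathsf{OPT}(V_1,\ldots,V_T)$.
   Context: Setting (single-item dynamic pricing, deterministic valuations). Fix $m\ge1$, prices $0<r^{(1)}<\cdots<r^{(m)}$, $\mathcal{P}=\{r^{(1)},\ldots,r^{(m)}\}$, $r^{(0)}=0$. A firm has $k\ge1$ units. Customers $t=1,\ldots,T$ have valuations $V_t\in\{r^{(0)},\ldots,r^{(m)}\}$; when offered price $P_t$ with inventory remaining, customer $t$ buys (revenue $P_t$, one unit consumed) iff $V_t\ge P_t$. $\mathsf{ALG}$ is total revenue; $\mathsf{OPT}(V_1,\ldots,V_T)$ is the sum of the $\min\{k,T\}$ largest valuations. Let $q^{(j)}=1-r^{(j-1)}/r^{(j)}$, $q=\sum_jq^{(j)}$, $c^*(\mathcal{P})=1/q$. -}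

module Defs where

open import Data.Nat using (ℕ; zero; suc)
open import Data.Fin using (Fin; zero; suc; inject₁)
open import Data.List using (List; []; _∷_; map; take; reverse; allFin; foldr)
open import Data.Rational using (ℚ; 0ℚ; 1ℚ; _+_; _*_; _-_; _÷_; _≤_; ≢-nonZero)
open import Data.Rational.Properties using (_≤?_; _≟_; ≤-decTotalOrder)
open import Relation.Nullary using (yes; no)
open import Data.List.Sort ≤-decTotalOrder using (sort)

sumℚ : List ℚ → ℚ
sumℚ = foldr _+_ 0ℚ

-- Total division on ℚ (only ever applied to nonzero divisors in the statement,
-- where it coincides with the usual division).
_⊘_ : ℚ → ℚ → ℚ
p ⊘ d with d ≟ 0ℚ
... | yes _ = 0ℚ
... | no d≢0 = _÷_ p d {{≢-nonZero d≢0}}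

-- Extended price grid: r⁰ r (zero) = r^(0) = 0, r⁰ r (suc j) = r^(j+1).
r⁰ : ∀ {m} → (Fin m → ℚ) → Fin (suc m) → ℚ
r⁰ r zero = 0ℚ
r⁰ r (suc j) = r j

-- q^(j) = 1 - r^(j-1) / r^(j)   (index j : Fin m denotes price r^(j+1))
qj : ∀ {m} → (Fin m → ℚ) → Fin m → ℚ
qj r j = 1ℚ - (r⁰ r (inject₁ j) ⊘ r j)

qsum : ∀ {m} → (Fin m → ℚ) → ℚ
qsum {m} r = sumℚ (map (qj r) (allFin m))

cstar : ∀ {m} → (Fin m → ℚ) → ℚ
cstar r = 1ℚ ⊘ qsum r

fixedPriceRevenue : ℚ → ℕ → List ℚ → ℚ
fixedPriceRevenue p zero vs = 0ℚ
fixedPriceRevenue p (suc n) [] = 0ℚ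
fixedPriceRevenue p (suc n) (v ∷ vs) with p ≤? v
... | yes _ = p + fixedPriceRevenue p n vs
... | no _ = fixedPriceRevenue p (suc n) vs

expectedRFP : ∀ {m} → (Fin m → ℚ) → ℕ → List ℚ → ℚ
expectedRFP {m} r k vs =
  sumℚ (map (λ j → (qj r j ⊘ qsum r) * fixedPriceRevenue (r j) k vs) (allFin m))

OPT : ℕ → List ℚ → ℚ
OPT k vs = sumℚ (take k (reverse (sort vs)))

{-# OPTIONS --safe #-}
module Submission where

-- A lone customer of valuation r⁽ⁱ⁾ facing one unit pays r⁽ʲ⁾ exactly when j ≤ i, so the
-- random price earns Σ_{j≤i} q⁽ʲ⁾ r⁽ʲ⁾ / q = Σ_{j≤i} (r⁽ʲ⁾ − r⁽ʲ⁻¹⁾) / q = r⁽ⁱ⁾ / q.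
-- Revenue at a fixed price does not depend on the order of the customers, so we may sort
-- them decreasingly; then the first customer either buys or nobody does, and the revenue
-- with k units is that of the first customer with one unit plus that of the others with
-- k − 1 units. By induction on k the expected revenue is exactly OPT / q, for all m, k, T.

open import Defs
open import Data.Nat using (ℕ; suc; _<_)
open import Data.Fin using (Fin; toℕ)
open import Data.Vec using (Vec; toList; map)
open import Data.Rational using (ℚ; 0ℚ; _*_) renaming (_<_ to _<ℚ_; _≤_ to _≤ℚ_)

open import Algebra.Bundles using (CommutativeRing)
open import Data.Empty using (⊥-elim)
open import Data.Fin using (zero; suc; inject₁)
import Data.Fin as Fin
open import Data.List as List using (List; []; _∷_; take; reverse; tabulate)
open import Data.List.Properties using (unfold-reverse)
open import Data.List.Relation.Binary.Permutation.Propositional using (_↭_; refl; prep; swap; trans; ↭-sym; ↭-trans)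
open import Data.List.Relation.Binary.Permutation.Propositional.Properties using (All-resp-↭; ↭-reverse)
open import Data.List.Relation.Unary.All as All using (All; []; _∷_)
open import Data.List.Relation.Unary.All.Properties using (map⁺)
open import Data.List.Relation.Unary.AllPairs using (AllPairs; []; _∷_)
import Data.List.Relation.Unary.AllPairs.Properties as AllPairs
open import Data.List.Relation.Unary.Linked.Properties using (Linked⇒AllPairs)
open import Data.Nat using (z≤n; s≤s)
open import Data.Rational using (1ℚ; _+_; _-_; -_; 1/_; ≢-nonZero)
open import Data.Rational.Properties
open import Data.Rational.Solver using (module +-*-Solver)
open import Data.List.Sort ≤-decTotalOrder using (sort; sort-↭; sort-↗)
open import Data.Vec.Properties using (toList-map)
open import Function using (_∘_; id; flip)
open import Relation.Binary.Core using (Rel; _Preserves_⟶_)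
open import Relation.Binary.PropositionalEquality using (_≡_; _≢_; ≢-sym; refl; sym; cong; cong₂; subst; module ≡-Reasoning)
  renaming (trans to ≡-trans)
open import Relation.Nullary using (Dec; yes; no; ¬_)

open import Algebra.Properties.Semiring.Sum (CommutativeRing.semiring +-*-commutativeRing)
  using (sum; sum-syntax; sum-cong-≗; sum-replicate-zero; ∑-distrib-+; *-distribˡ-sum)

open ≡-Reasoning

sumℚ-map-tabulate : ∀ {A : Set} {n} (f : A → ℚ) (g : Fin n → A) →
  sumℚ (List.map f (tabulate g)) ≡ sum (f ∘ g)
sumℚ-map-tabulate {n = ℕ.zero} f g = refl
sumℚ-map-tabulate {n = suc n} f g = cong (f (g zero) +_) (sumℚ-map-tabulate f (g ∘ suc))

sum-zero : ∀ {n} {f : Fin n → ℚ} → (∀ j → f j ≡ 0ℚ) → sum f ≡ 0ℚ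
sum-zero {n} f≡0 = ≡-trans (sum-cong-≗ f≡0) (sum-replicate-zero n)

AllPairs-reverse : ∀ {A : Set} {ℓ} {R : Rel A ℓ} {xs} → AllPairs R xs → AllPairs (flip R) (reverse xs)
AllPairs-reverse [] = []
AllPairs-reverse {xs = x ∷ xs} (Rx ∷ Rxs) rewrite unfold-reverse x xs =
  AllPairs.++⁺ (AllPairs-reverse Rxs) ([] ∷ [])
    (All.map (_∷ []) (All-resp-↭ (↭-sym (↭-reverse xs)) Rx))

-- Also for d = 0, where both sides are the junk value 0; so q = 0 needs no separate case.
p⊘d≡p*[1⊘d] : ∀ p d → p ⊘ d ≡ p * (1ℚ ⊘ d)
p⊘d≡p*[1⊘d] p d with d ≟ 0ℚ
... | yes _ = sym (*-zeroʳ p)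
... | no _ = cong (p *_) (sym (*-identityˡ _))

⊘-*-cancel : ∀ p {d} → d ≢ 0ℚ → (p ⊘ d) * d ≡ p
⊘-*-cancel p {d} d≢0 with d ≟ 0ℚ
... | yes d≡0 = ⊥-elim (d≢0 d≡0)
... | no d≢0 = begin
  p * (1/ d) * d   ≡⟨ *-assoc p _ d ⟩
  p * ((1/ d) * d) ≡⟨ cong (p *_) (*-inverseˡ d) ⟩
  p * 1ℚ           ≡⟨ *-identityʳ p ⟩
  p                ∎
  where instance _ = ≢-nonZero d≢0

qj*r≡r-r⁰ : ∀ {m} (r : Fin m → ℚ) j → r j ≢ 0ℚ → qj r j * r j ≡ r j - r⁰ r (inject₁ j)
qj*r≡r-r⁰ r j rj≢0 = begin
  (1ℚ - a ⊘ r j) * r j          ≡⟨ *-distribʳ-+ (r j) 1ℚ (- (a ⊘ r j)) ⟩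
  1ℚ * r j + - (a ⊘ r j) * r j  ≡⟨ cong₂ _+_ (*-identityˡ (r j)) (sym (neg-distribˡ-* (a ⊘ r j) (r j))) ⟩
  r j - (a ⊘ r j) * r j         ≡⟨ cong (λ x → r j - x) (⊘-*-cancel a rj≢0) ⟩
  r j - a                       ∎
  where a = r⁰ r (inject₁ j)

𝟙[_≤_] : ℚ → ℚ → ℚ
𝟙[ p ≤ x ] with p ≤? x
... | yes _ = 1ℚ
... | no _ = 0ℚ

𝟙-accept : ∀ {p x} → p ≤ℚ x → 𝟙[ p ≤ x ] ≡ 1ℚ
𝟙-accept {p} {x} p≤x with p ≤? x
... | yes _ = refl
... | no p≰x = ⊥-elim (p≰x p≤x)

𝟙-reject : ∀ {p x} → ¬ p ≤ℚ x → 𝟙[ p ≤ x ] ≡ 0ℚ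
𝟙-reject {p} {x} p≰x with p ≤? x
... | yes p≤x = ⊥-elim (p≰x p≤x)
... | no _ = refl

telescope : ∀ {n} (s : Fin (suc n) → ℚ) → s Preserves Fin._<_ ⟶ _<ℚ_ → ∀ i →
  ∑[ j < n ] ((s (suc j) - s (inject₁ j)) * 𝟙[ s (suc j) ≤ s i ]) ≡ s i - s zero
telescope s mono zero = ≡-trans (sum-zero unpaid) (sym (+-inverseʳ (s zero)))
  where
  unpaid : ∀ j → (s (suc j) - s (inject₁ j)) * 𝟙[ s (suc j) ≤ s zero ] ≡ 0ℚ
  unpaid j = ≡-trans (cong ((s (suc j) - s (inject₁ j)) *_) (𝟙-reject s₀≱sⱼ)) (*-zeroʳ (s (suc j) - s (inject₁ j)))
    where
    s₀≱sⱼ : ¬ s (suc j) ≤ℚ s zero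
    s₀≱sⱼ = <-irrefl refl ∘ <-≤-trans (mono {zero} {suc j} (s≤s z≤n))
telescope {suc n} s mono (suc i) = begin
  (s₁ - s₀) * 𝟙[ s₁ ≤ s (suc i) ] + ∑[ j < n ] ((s (suc (suc j)) - s (suc (inject₁ j))) * 𝟙[ s (suc (suc j)) ≤ s (suc i) ])
    ≡⟨ cong₂ _+_ (≡-trans (cong ((s₁ - s₀) *_) (𝟙-accept s₁≤s[1+ i ])) (*-identityʳ (s₁ - s₀)))
                 (telescope (s ∘ suc) (λ {i} {j} i<j → mono {suc i} {suc j} (s≤s i<j)) i) ⟩
  (s₁ - s₀) + (s (suc i) - s₁)
    ≡⟨ solve 3 (λ a b c → (b :- a) :+ (c :- b) := c :- a) refl s₀ s₁ (s (suc i)) ⟩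
  s (suc i) - s₀ ∎
  where
  open +-*-Solver
  s₀ s₁ : ℚ
  s₀ = s zero
  s₁ = s (suc zero)
  s₁≤s[1+_] : ∀ i → s₁ ≤ℚ s (suc i)
  s₁≤s[1+ zero ] = ≤-refl
  s₁≤s[1+ suc i ] = <⇒≤ (mono {suc zero} {suc (suc i)} (s≤s (s≤s z≤n)))

fixedPriceRevenue-accept : ∀ {p v} n vs → p ≤ℚ v →
  fixedPriceRevenue p (suc n) (v ∷ vs) ≡ p + fixedPriceRevenue p n vs
fixedPriceRevenue-accept {p} {v} n vs p≤v with p ≤? v
... | yes _ = refl
... | no p≰v = ⊥-elim (p≰v p≤v)

fixedPriceRevenue-reject : ∀ {p v} n vs → ¬ p ≤ℚ v →
  fixedPriceRevenue p n (v ∷ vs) ≡ fixedPriceRevenue p n vs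
fixedPriceRevenue-reject ℕ.zero vs p≰v = refl
fixedPriceRevenue-reject {p} {v} (suc n) vs p≰v with p ≤? v
... | yes p≤v = ⊥-elim (p≰v p≤v)
... | no _ = refl

fixedPriceRevenue-single : ∀ p x → fixedPriceRevenue p 1 (x ∷ []) ≡ p * 𝟙[ p ≤ x ]
fixedPriceRevenue-single p x with p ≤? x
... | yes _ = ≡-trans (+-identityʳ p) (sym (*-identityʳ p))
... | no _ = sym (*-zeroʳ p)

fixedPriceRevenue-unsold : ∀ {p vs} → All (λ v → ¬ p ≤ℚ v) vs → ∀ n → fixedPriceRevenue p n vs ≡ 0ℚ
fixedPriceRevenue-unsold [] ℕ.zero = refl
fixedPriceRevenue-unsold [] (suc n) = refl
fixedPriceRevenue-unsold {vs = v ∷ vs} (p≰v ∷ p≰vs) n =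
  ≡-trans (fixedPriceRevenue-reject n vs p≰v) (fixedPriceRevenue-unsold p≰vs n)

fixedPriceRevenue-∷ : ∀ {p} x {vs ws} → (∀ n → fixedPriceRevenue p n vs ≡ fixedPriceRevenue p n ws) →
  ∀ n → fixedPriceRevenue p n (x ∷ vs) ≡ fixedPriceRevenue p n (x ∷ ws)
fixedPriceRevenue-∷ x vs≈ws ℕ.zero = refl
fixedPriceRevenue-∷ {p} x vs≈ws (suc n) with p ≤? x
... | yes _ = cong (p +_) (vs≈ws n)
... | no _ = vs≈ws (suc n)

fixedPriceRevenue-swap : ∀ p x y vs n →
  fixedPriceRevenue p n (x ∷ y ∷ vs) ≡ fixedPriceRevenue p n (y ∷ x ∷ vs)
fixedPriceRevenue-swap p x y vs n = swapped (p ≤? x) (p ≤? y) n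
  where
  swapped : Dec (p ≤ℚ x) → Dec (p ≤ℚ y) → ∀ n →
    fixedPriceRevenue p n (x ∷ y ∷ vs) ≡ fixedPriceRevenue p n (y ∷ x ∷ vs)
  swapped _ _ ℕ.zero = refl
  swapped (yes p≤x) (yes p≤y) (suc n) = begin
    fixedPriceRevenue p (suc n) (x ∷ y ∷ vs) ≡⟨ fixedPriceRevenue-accept n _ p≤x ⟩
    p + fixedPriceRevenue p n (y ∷ vs)       ≡⟨ cong (p +_) (heads n) ⟩
    p + fixedPriceRevenue p n (x ∷ vs)       ≡⟨ fixedPriceRevenue-accept n _ p≤y ⟨
    fixedPriceRevenue p (suc n) (y ∷ x ∷ vs) ∎
    where
    heads : ∀ n → fixedPriceRevenue p n (y ∷ vs) ≡ fixedPriceRevenue p n (x ∷ vs)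
    heads ℕ.zero = refl
    heads (suc n) = ≡-trans (fixedPriceRevenue-accept n vs p≤y) (sym (fixedPriceRevenue-accept n vs p≤x))
  swapped (no p≰x) _ n = ≡-trans (fixedPriceRevenue-reject n _ p≰x)
    (sym (fixedPriceRevenue-∷ y (λ n → fixedPriceRevenue-reject n vs p≰x) n))
  swapped (yes _) (no p≰y) n = ≡-trans (fixedPriceRevenue-∷ x (λ n → fixedPriceRevenue-reject n vs p≰y) n)
    (sym (fixedPriceRevenue-reject n _ p≰y))

fixedPriceRevenue-↭ : ∀ p {vs ws} → vs ↭ ws → ∀ n → fixedPriceRevenue p n vs ≡ fixedPriceRevenue p n ws
fixedPriceRevenue-↭ p refl n = refl
fixedPriceRevenue-↭ p (prep x vs↭ws) = fixedPriceRevenue-∷ x (fixedPriceRevenue-↭ p vs↭ws)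
fixedPriceRevenue-↭ p (swap x y vs↭ws) n = ≡-trans (fixedPriceRevenue-swap p x y _ n)
  (fixedPriceRevenue-∷ y (fixedPriceRevenue-∷ x (fixedPriceRevenue-↭ p vs↭ws)) n)
fixedPriceRevenue-↭ p (trans us↭vs vs↭ws) n =
  ≡-trans (fixedPriceRevenue-↭ p us↭vs n) (fixedPriceRevenue-↭ p vs↭ws n)

fixedPriceRevenue-split : ∀ p {x w} → All (_≤ℚ x) w → ∀ k →
  fixedPriceRevenue p (suc k) (x ∷ w) ≡ fixedPriceRevenue p 1 (x ∷ []) + fixedPriceRevenue p k w
fixedPriceRevenue-split p {x} {w} w≤x k = split (p ≤? x)
  where
  split : Dec (p ≤ℚ x) →
    fixedPriceRevenue p (suc k) (x ∷ w) ≡ fixedPriceRevenue p 1 (x ∷ []) + fixedPriceRevenue p k w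
  split (yes p≤x) = begin
    fixedPriceRevenue p (suc k) (x ∷ w)                         ≡⟨ fixedPriceRevenue-accept k w p≤x ⟩
    p + fixedPriceRevenue p k w                                 ≡⟨ cong (_+ fixedPriceRevenue p k w) (+-identityʳ p) ⟨
    (p + 0ℚ) + fixedPriceRevenue p k w                          ≡⟨ cong (_+ fixedPriceRevenue p k w) (fixedPriceRevenue-accept 0 [] p≤x) ⟨
    fixedPriceRevenue p 1 (x ∷ []) + fixedPriceRevenue p k w    ∎
  split (no p≰x) = begin
    fixedPriceRevenue p (suc k) (x ∷ w)                         ≡⟨ fixedPriceRevenue-reject (suc k) w p≰x ⟩
    fixedPriceRevenue p (suc k) w                               ≡⟨ unsold (suc k) ⟩
    0ℚ                                                          ≡⟨ +-identityʳ 0ℚ ⟨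
    0ℚ + 0ℚ                                                     ≡⟨ cong₂ _+_ (fixedPriceRevenue-reject 1 [] p≰x) (unsold k) ⟨
    fixedPriceRevenue p 1 (x ∷ []) + fixedPriceRevenue p k w    ∎
    where
    unsold : ∀ n → fixedPriceRevenue p n w ≡ 0ℚ
    unsold = fixedPriceRevenue-unsold (All.map (λ v≤x p≤v → p≰x (≤-trans p≤v v≤x)) w≤x)

mixedPriceRevenue : ∀ {m} → (Fin m → ℚ) → (Fin m → ℚ) → ℕ → List ℚ → ℚ
mixedPriceRevenue {m} a p k vs = ∑[ j < m ] (a j * fixedPriceRevenue (p j) k vs)

ExtractsValuation : ∀ {m} → (Fin m → ℚ) → (Fin m → ℚ) → ℚ → Set
ExtractsValuation a p x = mixedPriceRevenue a p 1 (x ∷ []) ≡ x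

mixedPriceRevenue-↭ : ∀ {m} (a p : Fin m → ℚ) k {vs ws} → vs ↭ ws →
  mixedPriceRevenue a p k vs ≡ mixedPriceRevenue a p k ws
mixedPriceRevenue-↭ a p k vs↭ws = sum-cong-≗ (λ j → cong (a j *_) (fixedPriceRevenue-↭ (p j) vs↭ws k))

mixedPriceRevenue-sorted : ∀ {m} (a p : Fin m → ℚ) {w} → AllPairs (flip _≤ℚ_) w →
  All (ExtractsValuation a p) w → ∀ k → mixedPriceRevenue a p k w ≡ sumℚ (take k w)
mixedPriceRevenue-sorted a p _ _ ℕ.zero = sum-zero (λ j → *-zeroʳ (a j))
mixedPriceRevenue-sorted a p [] [] (suc k) = sum-zero (λ j → *-zeroʳ (a j))
mixedPriceRevenue-sorted {m} a p {x ∷ w} (w≤x ∷ sorted) (x-extracted ∷ extracted) (suc k) = begin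
  mixedPriceRevenue a p (suc k) (x ∷ w)
    ≡⟨ sum-cong-≗ (λ j → ≡-trans (cong (a j *_) (fixedPriceRevenue-split (p j) w≤x k)) (*-distribˡ-+ (a j) _ _)) ⟩
  ∑[ j < m ] (a j * fixedPriceRevenue (p j) 1 (x ∷ []) + a j * fixedPriceRevenue (p j) k w)
    ≡⟨ ∑-distrib-+ (λ j → a j * fixedPriceRevenue (p j) 1 (x ∷ [])) (λ j → a j * fixedPriceRevenue (p j) k w) ⟩
  mixedPriceRevenue a p 1 (x ∷ []) + mixedPriceRevenue a p k w
    ≡⟨ cong₂ _+_ x-extracted (mixedPriceRevenue-sorted a p sorted extracted k) ⟩
  x + sumℚ (take k w) ∎

OPT≡mixedPriceRevenue : ∀ {m} (a p : Fin m → ℚ) k {vs} → All (ExtractsValuation a p) vs →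
  OPT k vs ≡ mixedPriceRevenue a p k vs
OPT≡mixedPriceRevenue a p k {vs} extracted = begin
  OPT k vs                   ≡⟨ mixedPriceRevenue-sorted a p decreasing (All-resp-↭ (↭-sym w↭vs) extracted) k ⟨
  mixedPriceRevenue a p k w  ≡⟨ mixedPriceRevenue-↭ a p k w↭vs ⟩
  mixedPriceRevenue a p k vs ∎
  where
  w : List ℚ
  w = reverse (sort vs)
  w↭vs : w ↭ vs
  w↭vs = ↭-trans (↭-reverse (sort vs)) (sort-↭ vs)
  decreasing : AllPairs (flip _≤ℚ_) w
  decreasing = AllPairs-reverse (Linked⇒AllPairs ≤-trans (sort-↗ vs))

qj-extractsValuation : ∀ {m} (r : Fin m → ℚ) → (∀ j → 0ℚ <ℚ r j) →
  (∀ i j → toℕ i < toℕ j → r i <ℚ r j) → ∀ i → ExtractsValuation (qj r) r (r⁰ r i)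
qj-extractsValuation {m} r pos inc i = begin
  ∑[ j < m ] (qj r j * fixedPriceRevenue (r j) 1 (x ∷ []))            ≡⟨ sum-cong-≗ weighted-sale ⟩
  ∑[ j < m ] ((r⁰ r (suc j) - r⁰ r (inject₁ j)) * 𝟙[ r j ≤ x ])      ≡⟨ telescope (r⁰ r) increasing i ⟩
  x - 0ℚ                                                              ≡⟨ +-identityʳ x ⟩
  x                                                                   ∎
  where
  x : ℚ
  x = r⁰ r i
  weighted-sale : ∀ j → qj r j * fixedPriceRevenue (r j) 1 (x ∷ []) ≡ (r j - r⁰ r (inject₁ j)) * 𝟙[ r j ≤ x ]
  weighted-sale j = begin
    qj r j * fixedPriceRevenue (r j) 1 (x ∷ []) ≡⟨ cong (qj r j *_) (fixedPriceRevenue-single (r j) x) ⟩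
    qj r j * (r j * 𝟙[ r j ≤ x ])               ≡⟨ *-assoc (qj r j) (r j) _ ⟨
    qj r j * r j * 𝟙[ r j ≤ x ]                 ≡⟨ cong (_* 𝟙[ r j ≤ x ]) (qj*r≡r-r⁰ r j (≢-sym (<⇒≢ (pos j)))) ⟩
    (r j - r⁰ r (inject₁ j)) * 𝟙[ r j ≤ x ]     ∎
  increasing : r⁰ r Preserves Fin._<_ ⟶ _<ℚ_
  increasing {zero} {suc j} _ = pos j
  increasing {suc i} {suc j} (s≤s i<j) = inc i j i<j

expectedRFP≡cstar*mixedPriceRevenue : ∀ {m} (r : Fin m → ℚ) k vs →
  expectedRFP r k vs ≡ cstar r * mixedPriceRevenue (qj r) r k vs
expectedRFP≡cstar*mixedPriceRevenue {m} r k vs = begin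
  expectedRFP r k vs                                    ≡⟨ sumℚ-map-tabulate (λ j → (qj r j ⊘ qsum r) * revenue j) id ⟩
  ∑[ j < m ] ((qj r j ⊘ qsum r) * revenue j)            ≡⟨ sum-cong-≗ reweigh ⟩
  ∑[ j < m ] (cstar r * (qj r j * revenue j))           ≡⟨ *-distribˡ-sum (cstar r) (λ j → qj r j * revenue j) ⟨
  cstar r * mixedPriceRevenue (qj r) r k vs             ∎
  where
  revenue : Fin m → ℚ
  revenue j = fixedPriceRevenue (r j) k vs
  reweigh : ∀ j → (qj r j ⊘ qsum r) * revenue j ≡ cstar r * (qj r j * revenue j)
  reweigh j = begin
    (qj r j ⊘ qsum r) * revenue j          ≡⟨ cong (_* revenue j) (p⊘d≡p*[1⊘d] (qj r j) (qsum r)) ⟩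
    (qj r j * cstar r) * revenue j         ≡⟨ cong (_* revenue j) (*-comm (qj r j) (cstar r)) ⟩
    (cstar r * qj r j) * revenue j         ≡⟨ *-assoc (cstar r) (qj r j) (revenue j) ⟩
    cstar r * (qj r j * revenue j)         ∎

proposition2 : (m : ℕ) → 1 Data.Nat.≤ m → (r : Fin m → ℚ) → (∀ j → 0ℚ <ℚ r j) →
    (∀ i j → toℕ i < toℕ j → r i <ℚ r j) →
    (k : ℕ) → 1 Data.Nat.≤ k → (T : ℕ) → 1 Data.Nat.≤ T →
    (V : Vec (Fin (suc m)) T) →
    cstar r * OPT k (toList (map (r⁰ r) V)) ≤ℚ expectedRFP r k (toList (map (r⁰ r) V))
proposition2 m _ r pos inc k _ T _ V = ≤-reflexive (begin
  cstar r * OPT k vs                          ≡⟨ cong (cstar r *_) (OPT≡mixedPriceRevenue (qj r) r k extracted) ⟩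
  cstar r * mixedPriceRevenue (qj r) r k vs   ≡⟨ expectedRFP≡cstar*mixedPriceRevenue r k vs ⟨
  expectedRFP r k vs                          ∎)
  where
  vs : List ℚ
  vs = toList (map (r⁰ r) V)
  extracted : All (ExtractsValuation (qj r) r) vs
  extracted = subst (All _) (sym (toList-map (r⁰ r) V))
    (map⁺ (All.universal (qj-extractsValuation r pos inc) (toList V)))
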